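{- If $G$ is a connected biconvex graph, then $\gamma(G)\le 2\rho(G)$.
   Context: All graphs are finite and simple. A bipartite graph with parts $X,Y$ is biconvex if $X$ has an ordering in which $N(y)$ is a set of consecutive vertices for every $y\in Y$, and $Y$ has an ordering in which $N(x)$ is a set of consecutive vertices for every $x\in X$. $\gamma(G)$ is the minimum size of a dominating set (a set $D$ such that every vertex outside $D$ has a neighbor in $D$). A packing is a set of vertices with pairwise disjoint closed neighborhoods (equivalently pairwise distance at least $3$); $\rho(G)$ is the maximum size of a packing. -}

module Defs where

open import Data.Nat using (ℕ; _≤_; _<_)
open import Data.Fin using (Fin)
open import Data.Fin.Subset using (Subset; _∈_; _∉_; ∣_∣)
open import Data.Bool using (Bool; true; false)
open import Data.Sum using (_⊎_)
open import Data.Product using (Σ; _×_; ∃-syntax; _,_)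
open import Relation.Binary.PropositionalEquality using (_≡_; _≢_)
open import Relation.Nullary using (¬_)

record Graph : Set where
  field
    n      : ℕ
    adj    : Fin n → Fin n → Bool
    sym    : ∀ u v → adj u v ≡ adj v u
    irrefl : ∀ v → adj v v ≡ false

open Graph public

module _ (G : Graph) where

  V : Set
  V = Fin (n G)

  Adj : V → V → Set
  Adj u v = adj G u v ≡ true

  InClosedNbhd : V → V → Set
  InClosedNbhd v w = (w ≡ v) ⊎ Adj v w

  data Reach : V → V → Set where
    here : ∀ {u} → Reach u u
    step : ∀ {u v w} → Adj u v → Reach v w → Reach u w

  Connected : Set
  Connected = ∀ u v → Reach u v

  -- Bipartition: side v ≡ false means v ∈ X, side v ≡ true means v ∈ Y;
  -- every edge joins X and Y.
  IsBipartition : (V → Bool) → Set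
  IsBipartition side = ∀ u v → Adj u v → side u ≢ side v

  IsOrderingOf : (V → Bool) → Bool → (V → ℕ) → Set
  IsOrderingOf side s r =
    ∀ u v → side u ≡ s → side v ≡ s → r u ≡ r v → u ≡ v

  NbhdsConsecutive : (V → Bool) → Bool → (V → ℕ) → Set
  NbhdsConsecutive side s r =
    ∀ w a b c → side w ≢ s → Adj w a → Adj w b → side c ≡ s →
      r a ≤ r c → r c ≤ r b → Adj w c

  Biconvex : Set
  Biconvex = Σ (V → Bool) λ side → IsBipartition side ×
    (Σ (V → ℕ) λ rX → IsOrderingOf side false rX × NbhdsConsecutive side false rX) ×
    (Σ (V → ℕ) λ rY → IsOrderingOf side true rY × NbhdsConsecutive side true rY)

  IsDominating : Subset (n G) → Set
  IsDominating D = ∀ v → v ∉ D → ∃[ u ] (u ∈ D × Adj u v)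

  IsPacking : Subset (n G) → Set
  IsPacking P = ∀ u v → u ∈ P → v ∈ P → u ≢ v →
    ∀ w → ¬ (InClosedNbhd u w × InClosedNbhd v w)

  IsDominationNumber : ℕ → Set
  IsDominationNumber k =
    (∃[ D ] (IsDominating D × ∣ D ∣ ≡ k)) × (∀ D → IsDominating D → k ≤ ∣ D ∣)

  IsPackingNumber : ℕ → Set
  IsPackingNumber k =
    (∃[ P ] (IsPacking P × ∣ P ∣ ≡ k)) × (∀ P → IsPacking P → ∣ P ∣ ≤ k)

-- Fix one side of the bipartition together with its ordering r, in which the
-- neighbourhoods of the other side are intervals. Greedily take the r-least vertex x
-- not yet dominated, and a neighbour y of x whose neighbourhood reaches furthest in r.
-- If a remaining vertex x' shares a neighbour w with x, then r x ≤ r x' ≤ max r N(w)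
-- ≤ max r N(y), so x' ∈ N(y) by convexity. Hence the chosen x's form a packing that is
-- as large as the set of chosen y's, which dominates the side. Doing this on both
-- sides gives a dominating set of size at most 2ρ.

module Submission where

open import Defs hiding (sym)
open import Data.Bool using (Bool; true; false)
open import Data.Bool.Properties using () renaming (_≟_ to _≟ᵇ_)
open import Data.Empty using (⊥-elim)
open import Data.Fin using (Fin; _≟_)
open import Data.Fin.Properties using (any?)
open import Data.Fin.Subset
  using (Subset; _∈_; _∉_; _⊆_; ∣_∣; ⁅_⁆; _∪_; _─_; ⊥; Nonempty; Empty; inside; outside)
open import Data.Fin.Subset.Properties
  using (_∈?_; nonempty?; ∉⊥; x∈⁅x⁆; x∈⁅y⁆⇒x≡y; x∈p∪q⁺; x∈p∪q⁻; q⊆p∪q; p─q⊆p;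
         x∈p∧x∉q⇒x∈p─q; x∈p∩q⁺; p⊂q⇒∣p∣<∣q∣; p∩q≢∅⇒∣p─q∣<∣p∣; ∣⁅x⁆∣≡1)
open import Data.List using (List; filter; allFin; cartesianProduct)
import Data.List.Membership.Propositional as List
open import Data.List.Membership.Propositional.Properties
  using (∈-allFin; ∈-cartesianProduct⁺; ∈-filter⁺)
open import Data.List.Extrema.Nat
  using (argmin; argmax; argmin-all; argmax-all; f[argmin]≤f[xs]; f[xs]≤f[argmax])
open import Data.List.Relation.Unary.All using () renaming (lookup to lookupᴬ)
open import Data.List.Relation.Unary.All.Properties using (all-filter)
open import Data.Nat using (ℕ; _≤_; _<_; _+_; _*_; z≤n; s≤s)
open import Data.Nat.Induction using (<-wellFounded)
open import Data.Nat.Properties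
  using (≤-refl; ≤-trans; +-suc; +-identityʳ; +-mono-≤; +-monoʳ-≤; n≤1+n; module ≤-Reasoning)
open import Data.Product using (_×_; _,_; proj₁; proj₂; ∃-syntax)
open import Data.Sum using (_⊎_; inj₁; inj₂)
open import Data.Vec.Properties using (lookup∘tabulate; []=⇒lookup; lookup⇒[]=)
open import Data.Vec using (tabulate; []; _∷_; here; there)
open import Function using (_∘_)
open import Induction.WellFounded using (Acc; acc)
open import Level using (0ℓ)
open import Relation.Binary.PropositionalEquality using (_≡_; _≢_; refl; sym; trans; subst; cong)
open import Relation.Nullary using (¬_; yes; no; does)
open import Relation.Nullary.Decidable using (dec-true; _⊎-dec_; _×-dec_)
open import Relation.Unary using (Pred; Decidable)

module _ {A : Set} {xs : List A} (complete : ∀ a → a List.∈ xs) (f : A → ℕ)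
         {P : Pred A 0ℓ} (P? : Decidable P) where

  ∃-argmin : ∀ {a} → P a → ∃[ m ] (P m × ∀ b → P b → f m ≤ f b)
  ∃-argmin {a} pa =
    argmin f a ys , argmin-all f pa (all-filter P? xs) ,
    λ b pb → lookupᴬ (f[argmin]≤f[xs] a ys) (∈-filter⁺ P? (complete b) pb)
    where ys = filter P? xs

  ∃-argmax : ∀ {a} → P a → ∃[ m ] (P m × ∀ b → P b → f b ≤ f m)
  ∃-argmax {a} pa =
    argmax f a ys , argmax-all f pa (all-filter P? xs) ,
    λ b pb → lookupᴬ (f[xs]≤f[argmax] a ys) (∈-filter⁺ P? (complete b) pb)
    where ys = filter P? xs

module _ {n} {P : Pred (Fin n) 0ℓ} (P? : Decidable P) where

  ⟦_⟧ : Subset n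
  ⟦_⟧ = tabulate (does ∘ P?)

  ∈⟦⟧⁺ : ∀ {v} → P v → v ∈ ⟦_⟧
  ∈⟦⟧⁺ {v} pv = lookup⇒[]= v ⟦_⟧ (trans (lookup∘tabulate (does ∘ P?) v) (dec-true (P? v) pv))

  ∈⟦⟧⁻ : ∀ {v} → v ∈ ⟦_⟧ → P v
  ∈⟦⟧⁻ {v} v∈ with P? v | trans (sym (lookup∘tabulate (does ∘ P?) v)) ([]=⇒lookup v∈)
  ... | yes pv | _ = pv

∣p∪q∣≤∣p∣+∣q∣ : ∀ {n} (p q : Subset n) → ∣ p ∪ q ∣ ≤ ∣ p ∣ + ∣ q ∣
∣p∪q∣≤∣p∣+∣q∣ []            []            = z≤n
∣p∪q∣≤∣p∣+∣q∣ (inside ∷ p)  (inside ∷ q)  = s≤s (≤-trans (∣p∪q∣≤∣p∣+∣q∣ p q) (+-monoʳ-≤ ∣ p ∣ (n≤1+n ∣ q ∣)))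
∣p∪q∣≤∣p∣+∣q∣ (inside ∷ p)  (outside ∷ q) = s≤s (∣p∪q∣≤∣p∣+∣q∣ p q)
∣p∪q∣≤∣p∣+∣q∣ (outside ∷ p) (inside ∷ q)  rewrite +-suc ∣ p ∣ ∣ q ∣ = s≤s (∣p∪q∣≤∣p∣+∣q∣ p q)
∣p∪q∣≤∣p∣+∣q∣ (outside ∷ p) (outside ∷ q) = ∣p∪q∣≤∣p∣+∣q∣ p q

x∈p─q⇒x∉q : ∀ {n} {x : Fin n} (p q : Subset n) → x ∈ p ─ q → x ∉ q
x∈p─q⇒x∉q (inside ∷ p) (outside ∷ q) here       ()
x∈p─q⇒x∉q (_ ∷ p)      (_ ∷ q)       (there x∈) (there x∈q) = x∈p─q⇒x∉q p q x∈ x∈q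

∈-allFin² : ∀ {n} (p : Fin n × Fin n) → p List.∈ cartesianProduct (allFin n) (allFin n)
∈-allFin² (i , j) = ∈-cartesianProduct⁺ (∈-allFin i) (∈-allFin j)

module _ (G : Graph) where

  ClosedNbhdsDisjoint : V G → V G → Set
  ClosedNbhdsDisjoint u v = ∀ w → ¬ (InClosedNbhd G u w × InClosedNbhd G v w)

  Adj-sym : ∀ {u v} → Adj G u v → Adj G v u
  Adj-sym {u} {v} uv = trans (Graph.sym G v u) uv

  adj? : ∀ u → Decidable (Adj G u)
  adj? u v = adj G u v ≟ᵇ true

  inClosedNbhd? : ∀ u → Decidable (InClosedNbhd G u)
  inClosedNbhd? u w = (w ≟ u) ⊎-dec adj? u w

  N[_] : V G → Subset (n G)
  N[ u ] = ⟦ inClosedNbhd? u ⟧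

  walk₂? : ∀ x → Decidable (λ (p : V G × V G) → Adj G x (proj₁ p) × Adj G (proj₁ p) (proj₂ p))
  walk₂? x (y , b) = adj? x y ×-dec adj? y b

  part : (V G → Bool) → Bool → Subset (n G)
  part side s = ⟦ (λ v → side v ≟ᵇ s) ⟧

  ∈part⁺ : ∀ side {s v} → side v ≡ s → v ∈ part side s
  ∈part⁺ side {s} = ∈⟦⟧⁺ (λ v → side v ≟ᵇ s)

  ∈part⁻ : ∀ side {s v} → v ∈ part side s → side v ≡ s
  ∈part⁻ side {s} = ∈⟦⟧⁻ (λ v → side v ≟ᵇ s)

  part-false⊎part-true : ∀ side v → v ∈ part side false ⊎ v ∈ part side true
  part-false⊎part-true side v with side v in eq
  ... | false = inj₁ (∈part⁺ side eq)
  ... | true  = inj₂ (∈part⁺ side eq)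

  record Pivot (S : Subset (n G)) : Set where
    field
      pivot     : V G
      dominator : V G
      pivot∈S   : pivot ∈ S
      dominated : InClosedNbhd G dominator pivot
      separated : ∀ x → x ∈ S → ¬ InClosedNbhd G dominator x → ClosedNbhdsDisjoint pivot x

  isolatedPivot : ∀ {S x} → x ∈ S → (∀ y → ¬ Adj G x y) → Pivot S
  isolatedPivot {S} {x} x∈S isolated = record
    { pivot = x ; dominator = x ; pivot∈S = x∈S ; dominated = inj₁ refl ; separated = separated }
    where
    separated : ∀ v → v ∈ S → ¬ InClosedNbhd G x v → ClosedNbhdsDisjoint x v
    separated v _ v∉N[x] _ (inj₁ refl , inj₁ refl) = v∉N[x] (inj₁ refl)
    separated v _ _      _ (inj₁ refl , inj₂ vx)   = isolated v (Adj-sym vx)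
    separated v _ _      w (inj₂ xw   , _)         = isolated w xw

  record Cover (S : Subset (n G)) : Set where
    field
      dominators : Subset (n G)
      packing    : Subset (n G)
      dominates  : ∀ v → v ∈ S → ∃[ u ] (u ∈ dominators × InClosedNbhd G u v)
      isPacking  : IsPacking G packing
      packing⊆S  : packing ⊆ S
      ∣dominators∣≤∣packing∣ : ∣ dominators ∣ ≤ ∣ packing ∣

  emptyCover : ∀ {S} → Empty S → Cover S
  emptyCover empty = record
    { dominators = ⊥
    ; packing    = ⊥
    ; dominates  = λ v v∈S → ⊥-elim (empty (v , v∈S))
    ; isPacking  = λ u _ u∈⊥ → ⊥-elim (∉⊥ u∈⊥)
    ; packing⊆S  = λ x∈⊥ → ⊥-elim (∉⊥ x∈⊥)
    ; ∣dominators∣≤∣packing∣ = ≤-refl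
    }

  extendCover : ∀ {S} (p : Pivot S) → Cover (S ─ N[ Pivot.dominator p ]) → Cover S
  extendCover {S} p c = record
    { dominators = ⁅ y ⁆ ∪ D
    ; packing    = ⁅ x ⁆ ∪ P
    ; dominates  = dominates
    ; isPacking  = isPacking
    ; packing⊆S  = packing⊆S
    ; ∣dominators∣≤∣packing∣ = size
    }
    where
    open Pivot p renaming (pivot to x; dominator to y)
    open Cover c renaming (dominators to D; packing to P; dominates to D-dominates;
      isPacking to P-isPacking; packing⊆S to P⊆S─N[y]; ∣dominators∣≤∣packing∣ to ∣D∣≤∣P∣)

    ∉N[y] : ∀ {v} → v ∈ P → ¬ InClosedNbhd G y v
    ∉N[y] v∈P = x∈p─q⇒x∉q S N[ y ] (P⊆S─N[y] v∈P) ∘ ∈⟦⟧⁺ (inClosedNbhd? y)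

    separatedP : ∀ v → v ∈ P → ClosedNbhdsDisjoint x v
    separatedP v v∈P = separated v (p─q⊆p S N[ y ] (P⊆S─N[y] v∈P)) (∉N[y] v∈P)

    dominates : ∀ v → v ∈ S → ∃[ u ] (u ∈ ⁅ y ⁆ ∪ D × InClosedNbhd G u v)
    dominates v v∈S with inClosedNbhd? y v
    ... | yes yv = y , x∈p∪q⁺ (inj₁ (x∈⁅x⁆ y)) , yv
    ... | no ¬yv with D-dominates v (x∈p∧x∉q⇒x∈p─q v∈S (¬yv ∘ ∈⟦⟧⁻ (inClosedNbhd? y)))
    ...   | u , u∈D , uv = u , x∈p∪q⁺ (inj₂ u∈D) , uv

    isPacking : IsPacking G (⁅ x ⁆ ∪ P)
    isPacking u v u∈ v∈ u≢v w with x∈p∪q⁻ ⁅ x ⁆ P u∈ | x∈p∪q⁻ ⁅ x ⁆ P v∈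
    ... | inj₁ u∈⁅x⁆ | inj₁ v∈⁅x⁆ = λ _ → u≢v (trans (x∈⁅y⁆⇒x≡y x u∈⁅x⁆) (sym (x∈⁅y⁆⇒x≡y x v∈⁅x⁆)))
    ... | inj₁ u∈⁅x⁆ | inj₂ v∈P rewrite x∈⁅y⁆⇒x≡y x u∈⁅x⁆ = separatedP v v∈P w
    ... | inj₂ u∈P | inj₁ v∈⁅x⁆ rewrite x∈⁅y⁆⇒x≡y x v∈⁅x⁆ = λ (uw , xw) → separatedP u u∈P w (xw , uw)
    ... | inj₂ u∈P | inj₂ v∈P = P-isPacking u v u∈P v∈P u≢v w

    packing⊆S : ⁅ x ⁆ ∪ P ⊆ S
    packing⊆S v∈ with x∈p∪q⁻ ⁅ x ⁆ P v∈
    ... | inj₁ v∈⁅x⁆ = subst (_∈ S) (sym (x∈⁅y⁆⇒x≡y x v∈⁅x⁆)) pivot∈S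
    ... | inj₂ v∈P = p─q⊆p S N[ y ] (P⊆S─N[y] v∈P)

    size : ∣ ⁅ y ⁆ ∪ D ∣ ≤ ∣ ⁅ x ⁆ ∪ P ∣
    size = begin
      ∣ ⁅ y ⁆ ∪ D ∣      ≤⟨ ∣p∪q∣≤∣p∣+∣q∣ ⁅ y ⁆ D ⟩
      ∣ ⁅ y ⁆ ∣ + ∣ D ∣  ≡⟨ cong (_+ ∣ D ∣) (∣⁅x⁆∣≡1 y) ⟩
      1 + ∣ D ∣          ≤⟨ s≤s ∣D∣≤∣P∣ ⟩
      1 + ∣ P ∣          ≤⟨ p⊂q⇒∣p∣<∣q∣ (q⊆p∪q ⁅ x ⁆ P , x , x∈p∪q⁺ (inj₁ (x∈⁅x⁆ x)) , x∉P) ⟩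
      ∣ ⁅ x ⁆ ∪ P ∣      ∎
      where
      open ≤-Reasoning
      x∉P : x ∉ P
      x∉P x∈P = ∉N[y] x∈P dominated

  greedyCover : (T : Subset (n G)) → (∀ {S} → S ⊆ T → Nonempty S → Pivot S) → Cover T
  greedyCover T pivotOf = go (λ v∈T → v∈T) (<-wellFounded ∣ T ∣)
    where
    go : ∀ {S} → S ⊆ T → Acc _<_ ∣ S ∣ → Cover S
    go {S} S⊆T (acc rec) with nonempty? S
    ... | no empty = emptyCover empty
    ... | yes nonempty = extendCover p (go (S⊆T ∘ p─q⊆p S N[ y ]) (rec shrinks))
      where
      p = pivotOf S⊆T nonempty
      open Pivot p renaming (pivot to x; dominator to y)
      shrinks : ∣ S ─ N[ y ] ∣ < ∣ S ∣
      shrinks = p∩q≢∅⇒∣p─q∣<∣p∣ S N[ y ] (x , x∈p∩q⁺ (pivot∈S , ∈⟦⟧⁺ (inClosedNbhd? y) dominated))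

  closedDomination⇒Adj : ∀ {D u v} → u ∈ D → v ∉ D → InClosedNbhd G u v → Adj G u v
  closedDomination⇒Adj u∈D v∉D (inj₁ refl) = ⊥-elim (v∉D u∈D)
  closedDomination⇒Adj _   _   (inj₂ uv)   = uv

  covers-dominate : ∀ {S T} → (∀ v → v ∈ S ⊎ v ∈ T) → (c : Cover S) (d : Cover T) →
                    IsDominating G (Cover.dominators c ∪ Cover.dominators d)
  covers-dominate S⊎T c d v v∉D with S⊎T v
  ... | inj₁ v∈S with Cover.dominates c v v∈S
  ...   | u , u∈C , uv = u , x∈p∪q⁺ (inj₁ u∈C) , closedDomination⇒Adj (x∈p∪q⁺ (inj₁ u∈C)) v∉D uv
  covers-dominate S⊎T c d v v∉D | inj₂ v∈T with Cover.dominates d v v∈T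
  ...   | u , u∈C , uv = u , x∈p∪q⁺ (inj₂ u∈C) , closedDomination⇒Adj (x∈p∪q⁺ (inj₂ u∈C)) v∉D uv

module _ (G : Graph) (side : V G → Bool) (bipartite : IsBipartition G side)
         (s : Bool) (r : V G → ℕ) (convex : NbhdsConsecutive G side s r) where

  part-independent : ∀ {u v} → u ∈ part G side s → v ∈ part G side s → ¬ Adj G u v
  part-independent u∈ v∈ uv =
    bipartite _ _ uv (trans (∈part⁻ G side u∈) (sym (∈part⁻ G side v∈)))

  convexPivot : ∀ {S} → S ⊆ part G side s → Nonempty S → Pivot G S
  convexPivot {S} S⊆part (x₀ , x₀∈S) with ∃-argmin ∈-allFin r (_∈? S) x₀∈S
  ... | x , x∈S , x-min with any? (adj? G x)
  ...   | no ¬xy = isolatedPivot G x∈S (λ y xy → ¬xy (y , xy))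
  ...   | yes (y₀ , xy₀) with ∃-argmax ∈-allFin² (r ∘ proj₂) (walk₂? G x) (xy₀ , Adj-sym G xy₀)
  ...     | (y , b) , (xy , yb) , b-max = record
    { pivot = x ; dominator = y ; pivot∈S = x∈S ; dominated = inj₂ (Adj-sym G xy) ; separated = separated }
    where
    y∉part : side y ≢ s
    y∉part sy = bipartite x y xy (trans (∈part⁻ G side (S⊆part x∈S)) (sym sy))
    separated : ∀ v → v ∈ S → ¬ InClosedNbhd G y v → ClosedNbhdsDisjoint G x v
    separated v _ v∉N[y] _ (inj₁ refl , inj₁ refl) = v∉N[y] (inj₂ (Adj-sym G xy))
    separated v v∈S _ _ (inj₁ refl , inj₂ vx) = part-independent (S⊆part v∈S) (S⊆part x∈S) vx
    separated v v∈S _ _ (inj₂ xv , inj₁ refl) = part-independent (S⊆part x∈S) (S⊆part v∈S) xv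
    separated v v∈S v∉N[y] w (inj₂ xw , inj₂ vw) =
      v∉N[y] (inj₂ (convex y x b v y∉part (Adj-sym G xy) yb (∈part⁻ G side (S⊆part v∈S))
        (x-min v v∈S) (b-max (w , v) (xw , Adj-sym G vw))))

  partCover : Cover G (part G side s)
  partCover = greedyCover G (part G side s) convexPivot

theorem15 : (G : Graph) → Connected G → Biconvex G →
    (γ ρ : ℕ) → IsDominationNumber G γ → IsPackingNumber G ρ → γ ≤ 2 * ρ
theorem15 G _ (side , bipartite , (rX , _ , convexX) , (rY , _ , convexY)) γ ρ (_ , γ-min) (_ , ρ-max) =
  begin
    γ                  ≤⟨ γ-min (D X ∪ D Y) (covers-dominate G (part-false⊎part-true G side) X Y) ⟩
    ∣ D X ∪ D Y ∣      ≤⟨ ∣p∪q∣≤∣p∣+∣q∣ (D X) (D Y) ⟩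
    ∣ D X ∣ + ∣ D Y ∣  ≤⟨ +-mono-≤ (∣D∣≤ρ X) (∣D∣≤ρ Y) ⟩
    ρ + ρ              ≡⟨ cong (ρ +_) (sym (+-identityʳ ρ)) ⟩
    2 * ρ              ∎
  where
  open ≤-Reasoning
  X = partCover G side bipartite false rX convexX
  Y = partCover G side bipartite true rY convexY
  D : ∀ {S} → Cover G S → Subset (n G)
  D = Cover.dominators
  ∣D∣≤ρ : ∀ {S} (c : Cover G S) → ∣ D c ∣ ≤ ρ
  ∣D∣≤ρ c = ≤-trans (Cover.∣dominators∣≤∣packing∣ c) (ρ-max _ (Cover.isPacking c))
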